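{- Let $c>0$ and let $G=(V,E)$ be a $(c,3)$-expander graph with $n=|V|$, and let $V=V_1\uplus V_2$ be a balanced partition of $V$, i.e. $n/3\le|V_1|,|V_2|\le 2n/3$. Then there exists an induced matching $m$ of size $\Omega(n)$ between $V_1$ and $V_2$, where the constant in $\Omega$ depends only on $c$.
   Context: A graph is $d$-regular if all its vertices have degree $d$. A $(c,d)$-expander graph on vertex set $V$ is a $d$-regular graph such that for every $S\subseteq V$ with $|S|\le|V|/2$, $|N(S)|\ge c|S|$, where $N(S)=\{v\in V\setminus S : (u,v)\in E \text{ for some } u\in S\}$. An induced matching is a set $E'\subseteq E$ of edges with pairwise disjoint endpoints such that, letting $V'$ be the set of endpoints of edges of $E'$, every edge of $G$ with both endpoints in $V'$ is in $E'$; it is between $V_1$ and $V_2$ if each of its edges has one endpoint in $V_1$ and the other in $V_2$. Its size is its number of edges.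
   Formalization: The expansion constant $c$ of the $(c,3)$-expander is taken to be a positive rational. -}

module Defs where

open import Data.Nat using (ℕ; zero; suc; _+_; _*_; _≤_)
open import Data.Bool using (Bool; true; false; _∧_; _∨_; not)
open import Data.Fin using (Fin; zero; suc)
open import Data.Fin.Subset using (Subset; _∈_; _∉_; ∣_∣; ∁)
open import Data.Vec using (tabulate)
open import Data.Product using (_×_; _,_; proj₁; proj₂; Σ; ∃)
open import Data.Sum using (_⊎_)
open import Relation.Binary.PropositionalEquality using (_≡_; _≢_)
open import Data.Integer using (+_)
import Data.Rational as ℚ
open ℚ using (ℚ)

record Graph (n : ℕ) : Set where
  field
    adj    : Fin n → Fin n → Bool
    sym    : ∀ u v → adj u v ≡ adj v u
    irrefl : ∀ u → adj u u ≡ false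
open Graph public

anyFin : {n : ℕ} → (Fin n → Bool) → Bool
anyFin {zero}  f = false
anyFin {suc n} f = f zero ∨ anyFin (λ i → f (suc i))

_∈ᵇ_ : {n : ℕ} → Fin n → Subset n → Bool
_∈ᵇ_ {suc n} zero    (b Data.Vec.∷ s) = b
_∈ᵇ_ {suc n} (suc i) (b Data.Vec.∷ s) = i ∈ᵇ s

nbrs : {n : ℕ} → Graph n → Fin n → Subset n
nbrs G u = tabulate (adj G u)

degree : {n : ℕ} → Graph n → Fin n → ℕ
degree G u = ∣ nbrs G u ∣

IsRegular : {n : ℕ} → ℕ → Graph n → Set
IsRegular d G = ∀ u → degree G u ≡ d

N : {n : ℕ} → Graph n → Subset n → Subset n
N G S = tabulate (λ v → not (v ∈ᵇ S) ∧ anyFin (λ u → (u ∈ᵇ S) ∧ adj G u v))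

ℕtoℚ : ℕ → ℚ
ℕtoℚ k = (+ k) ℚ./ 1

IsExpander : {n : ℕ} → ℚ → ℕ → Graph n → Set
IsExpander {n} c d G =
  IsRegular d G ×
  (∀ (S : Subset n) → 2 * ∣ S ∣ ≤ n → c ℚ.* ℕtoℚ ∣ S ∣ ℚ.≤ ℕtoℚ ∣ N G S ∣)

-- Balanced partition V = V₁ ⊎ V₂ with V₂ = complement of V₁:
-- n/3 ≤ |V₁|, |V₂| ≤ 2n/3
IsBalanced : {n : ℕ} → Subset n → Set
IsBalanced {n} V₁ =
  (n ≤ 3 * ∣ V₁ ∣) × (3 * ∣ V₁ ∣ ≤ 2 * n) ×
  (n ≤ 3 * ∣ ∁ V₁ ∣) × (3 * ∣ ∁ V₁ ∣ ≤ 2 * n)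

EdgeFamily : ℕ → ℕ → Set
EdgeFamily n k = Fin k → Fin n × Fin n

IsEndpoint : {n k : ℕ} → EdgeFamily n k → Fin n → Set
IsEndpoint M x = ∃ λ i → (proj₁ (M i) ≡ x) ⊎ (proj₂ (M i) ≡ x)

EdgeIn : {n k : ℕ} → EdgeFamily n k → Fin n → Fin n → Set
EdgeIn M x y = ∃ λ i → ((proj₁ (M i) ≡ x) × (proj₂ (M i) ≡ y))
                     ⊎ ((proj₁ (M i) ≡ y) × (proj₂ (M i) ≡ x))

-- Induced matching (of size k): edges of G, pairwise disjoint endpoints
-- (distinct indices give disjoint edges, so the size is exactly k), and every
-- edge of G with both endpoints in V' is in M.
IsInducedMatching : {n k : ℕ} → Graph n → EdgeFamily n k → Set
IsInducedMatching G M =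
  (∀ i → adj G (proj₁ (M i)) (proj₂ (M i)) ≡ true) ×
  (∀ i j → i ≢ j →
     (proj₁ (M i) ≢ proj₁ (M j)) × (proj₁ (M i) ≢ proj₂ (M j)) ×
     (proj₂ (M i) ≢ proj₁ (M j)) × (proj₂ (M i) ≢ proj₂ (M j))) ×
  (∀ x y → IsEndpoint M x → IsEndpoint M y → adj G x y ≡ true → EdgeIn M x y)

IsBetween : {n k : ℕ} → EdgeFamily n k → Subset n → Subset n → Set
IsBetween M V₁ V₂ = ∀ i → (proj₁ (M i) ∈ V₁) × (proj₂ (M i) ∈ V₂)

{-# OPTIONS --safe #-}
-- Let S be the smaller side of the partition, so that expansion gives |N(S)| ≥ c|S| ≥ cn/3.
-- Greedily pick vertices of N(S) pairwise joined by no walk of length ≤ 3. In a 3-regular graph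
-- at most 1 + 3 + 9 + 27 = 40 vertices are reachable by such walks from a given vertex, so at
-- least |N(S)|/40 vertices get picked. Pairing every picked vertex with one of its neighbours in
-- S gives an induced matching: an edge between two different pairs, or a shared endpoint, would
-- join two picked vertices by a walk of length ≤ 3. Hence δ = c/120 works.
module Submission where

open import Defs
open import Data.Bool using (Bool; true; false; _∧_; _∨_; not)
open import Data.Bool.Properties using (∧-conicalˡ; ∧-conicalʳ; ∨-conicalˡ; ∨-conicalʳ; ∨-zeroʳ; ¬-not)
open import Data.Fin using (Fin; zero; suc)
open import Data.Fin.Subset using (Subset; ∁; ∣_∣; _∈_; _∉_)
open import Data.Nat using (ℕ; zero; suc)
import Data.Nat as ℕ
import Data.Nat.Properties as ℕₚ
open import Data.Product using (Σ; ∃; _×_; _,_; proj₁; proj₂; swap)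
open import Data.Sum using (_⊎_; inj₁; inj₂)
open import Data.Vec using (tabulate; _∷_; here; there)
open import Function using (_∘_)
open import Relation.Binary.PropositionalEquality using (_≡_; _≢_; refl; trans; cong; subst₂)
import Relation.Binary.PropositionalEquality as ≡
open import Relation.Nullary using (contradiction)

∧-intro : ∀ {a b} → a ≡ true → b ≡ true → a ∧ b ≡ true
∧-intro refl refl = refl

∨-introˡ : ∀ {a} b → a ≡ true → a ∨ b ≡ true
∨-introˡ b refl = refl

∨-introʳ : ∀ a {b} → b ≡ true → a ∨ b ≡ true
∨-introʳ a refl = ∨-zeroʳ a

∨-elim : ∀ a {b} → a ∨ b ≡ true → a ≡ true ⊎ b ≡ true
∨-elim true  _ = inj₁ refl
∨-elim false h = inj₂ h

anyFin-intro : ∀ {n} (f : Fin n → Bool) i → f i ≡ true → anyFin f ≡ true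
anyFin-intro f zero    h = ∨-introˡ _ h
anyFin-intro f (suc i) h = ∨-introʳ (f zero) (anyFin-intro (f ∘ suc) i h)

anyFin-elim : ∀ {n} (f : Fin n → Bool) → anyFin f ≡ true → ∃ λ i → f i ≡ true
anyFin-elim {suc n} f h with ∨-elim (f zero) h
... | inj₁ f0 = zero , f0
... | inj₂ fs with anyFin-elim (f ∘ suc) fs
...   | i , fi = suc i , fi

anyFin-false : ∀ {n} (f : Fin n → Bool) i → anyFin f ≡ false → f i ≡ false
anyFin-false f zero    h = ∨-conicalˡ _ _ h
anyFin-false f (suc i) h = anyFin-false (f ∘ suc) i (∨-conicalʳ _ _ h)

module Counting where

  open import Data.Nat using (_+_; _*_; _≤_; z≤n; s≤s)
  open import Data.Fin.Properties using (_≟_)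
  open import Relation.Nullary using (does)
  open import Algebra.Properties.Semiring.Sum ℕₚ.+-*-semiring
    using (sum; ∑-distrib-+; *-distribʳ-sum; sum-replicate-zero)

  boolToℕ : Bool → ℕ
  boolToℕ false = 0
  boolToℕ true  = 1

  count : ∀ {n} → (Fin n → Bool) → ℕ
  count f = sum (boolToℕ ∘ f)

  ∣tabulate∣≡count : ∀ {n} (f : Fin n → Bool) → ∣ tabulate f ∣ ≡ count f
  ∣tabulate∣≡count {zero}  f = refl
  ∣tabulate∣≡count {suc n} f with f zero
  ... | true  = cong suc (∣tabulate∣≡count (f ∘ suc))
  ... | false = ∣tabulate∣≡count (f ∘ suc)

  sum-mono : ∀ {n} {f g : Fin n → ℕ} → (∀ i → f i ≤ g i) → sum f ≤ sum g
  sum-mono {zero}  f≤g = z≤n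
  sum-mono {suc n} f≤g = ℕₚ.+-mono-≤ (f≤g zero) (sum-mono (f≤g ∘ suc))

  sum-const : ∀ n x → sum {n} (λ _ → x) ≡ n * x
  sum-const zero    x = refl
  sum-const (suc n) x = cong (x +_) (sum-const n x)

  count-mono : ∀ {n} {f g : Fin n → Bool} → (∀ i → f i ≡ true → g i ≡ true) → count f ≤ count g
  count-mono {f = f} f⇒g = sum-mono λ i → boolToℕ-mono (f i) (f⇒g i)
    where
    boolToℕ-mono : ∀ a {b} → (a ≡ true → b ≡ true) → boolToℕ a ≤ boolToℕ b
    boolToℕ-mono false _ = z≤n
    boolToℕ-mono true  h rewrite h refl = s≤s z≤n

  count-∨ : ∀ {n} (f g : Fin n → Bool) → count (λ i → f i ∨ g i) ≤ count f + count g
  count-∨ f g = ℕₚ.≤-trans (sum-mono λ i → boolToℕ-∨ (f i) (g i))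
                          (ℕₚ.≤-reflexive (∑-distrib-+ (boolToℕ ∘ f) (boolToℕ ∘ g)))
    where
    boolToℕ-∨ : ∀ a b → boolToℕ (a ∨ b) ≤ boolToℕ a + boolToℕ b
    boolToℕ-∨ true  _ = s≤s z≤n
    boolToℕ-∨ false _ = ℕₚ.≤-refl

  count-∧ : ∀ {n} b (f : Fin n → Bool) → count (λ i → b ∧ f i) ≡ boolToℕ b * count f
  count-∧ true  f = ≡.sym (ℕₚ.+-identityʳ (count f))
  count-∧ {n} false f = sum-replicate-zero n

  count-anyFin : ∀ {m n} (h : Fin m → Fin n → Bool) →
    count (λ w → anyFin (λ a → h a w)) ≤ sum (λ a → count (h a))
  count-anyFin {zero} {n} h = ℕₚ.≤-reflexive (sum-replicate-zero n)
  count-anyFin {suc m} h = ℕₚ.≤-trans (count-∨ (h zero) (λ w → anyFin (λ a → h (suc a) w)))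
                                     (ℕₚ.+-monoʳ-≤ (count (h zero)) (count-anyFin (h ∘ suc)))

  count-≟ : ∀ {n} (v : Fin n) → count (λ w → does (v ≟ w)) ≤ 1
  count-≟ {suc n} zero    = ℕₚ.≤-reflexive (cong suc (sum-replicate-zero n))
  count-≟ {suc n} (suc v) = count-≟ v

  count-weighted : ∀ {n} (f : Fin n → Bool) d → sum (λ i → boolToℕ (f i) * d) ≡ count f * d
  count-weighted f d = ≡.sym (*-distribʳ-sum d (boolToℕ ∘ f))

open Counting using (count; ∣tabulate∣≡count)

∈ᵇ⇒∈ : ∀ {n} (x : Fin n) (S : Subset n) → x ∈ᵇ S ≡ true → x ∈ S
∈ᵇ⇒∈ zero    (true ∷ S) h = here
∈ᵇ⇒∈ (suc x) (_ ∷ S)    h = there (∈ᵇ⇒∈ x S h)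

not-∈ᵇ⇒∉ : ∀ {n} (x : Fin n) (S : Subset n) → not (x ∈ᵇ S) ≡ true → x ∉ S
not-∈ᵇ⇒∉ zero    (false ∷ S) h ()
not-∈ᵇ⇒∉ (suc x) (_ ∷ S)     h (there x∈S) = not-∈ᵇ⇒∉ x S h x∈S

ballBound : ℕ → ℕ → ℕ
ballBound d zero    = 1
ballBound d (suc r) = ballBound d r ℕ.+ d ℕ.^ suc r

module Walks {n : ℕ} (G : Graph n) where

  open import Data.Nat using (_*_; _^_; _≤_; z≤n; s≤s)
  open import Data.Fin.Properties using (_≟_)
  open import Relation.Nullary using (does; yes)
  open import Relation.Nullary.Decidable using (dec-true)
  open import Algebra.Properties.Semiring.Sum ℕₚ.+-*-semiring using (sum; sum-cong-≗)
  open Counting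

  walk : ℕ → Fin n → Fin n → Bool
  walk zero    v w = does (v ≟ w)
  walk (suc k) v w = anyFin (λ a → walk k v a ∧ adj G a w)

  within : ℕ → Fin n → Fin n → Bool
  within zero    v w = walk zero v w
  within (suc r) v w = within r v w ∨ walk (suc r) v w

  adj-sym : ∀ {u v} → adj G u v ≡ true → adj G v u ≡ true
  adj-sym {u} {v} h = trans (sym G v u) h

  walk-refl : ∀ v → walk 0 v v ≡ true
  walk-refl v = dec-true (v ≟ v) refl

  walk₀⇒≡ : ∀ {v w} → walk 0 v w ≡ true → v ≡ w
  walk₀⇒≡ {v} {w} h with v ≟ w
  ... | yes v≡w = v≡w

  walk-snoc : ∀ k {v a w} → walk k v a ≡ true → adj G a w ≡ true → walk (suc k) v w ≡ true
  walk-snoc k {a = a} p e = anyFin-intro _ a (∧-intro p e)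

  walk-unsnoc : ∀ {k v w} → walk (suc k) v w ≡ true →
    ∃ λ a → walk k v a ≡ true × adj G a w ≡ true
  walk-unsnoc h with anyFin-elim _ h
  ... | a , p = a , ∧-conicalˡ _ _ p , ∧-conicalʳ _ _ p

  walk-cons : ∀ k {v a w} → adj G v a ≡ true → walk k a w ≡ true → walk (suc k) v w ≡ true
  walk-cons zero    {v} {a} {w} e p with refl ← walk₀⇒≡ {a} {w} p = walk-snoc 0 {v} {v} (walk-refl v) e
  walk-cons (suc k) {v} {a} {w} e p with walk-unsnoc {k} {a} {w} p
  ... | b , p′ , e′ = walk-snoc (suc k) (walk-cons k e p′) e′

  walk-sym : ∀ k {v w} → walk k v w ≡ true → walk k w v ≡ true
  walk-sym zero    {v} {w} p with refl ← walk₀⇒≡ {v} {w} p = walk-refl v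
  walk-sym (suc k) {v} {w} p with walk-unsnoc {k} {v} {w} p
  ... | a , p′ , e = walk-cons k (adj-sym e) (walk-sym k p′)

  within-sym : ∀ r {v w} → within r v w ≡ true → within r w v ≡ true
  within-sym zero    {v} {w} p = walk-sym 0 {v} {w} p
  within-sym (suc r) {v} {w} p with ∨-elim (within r v w) p
  ... | inj₁ q = ∨-introˡ _ (within-sym r q)
  ... | inj₂ q = ∨-introʳ (within r w v) (walk-sym (suc r) q)

  walk⇒within : ∀ {j} r {v w} → j ≤ r → walk j v w ≡ true → within r v w ≡ true
  walk⇒within zero    z≤n p = p
  walk⇒within (suc r) {v} {w} j≤1+r p with ℕₚ.m≤n⇒m<n∨m≡n j≤1+r
  ... | inj₁ (s≤s j≤r) = ∨-introˡ _ (walk⇒within r j≤r p)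
  ... | inj₂ refl      = ∨-introʳ (within r v w) p

  module _ {d : ℕ} (regular : IsRegular d G) where

    count-walk : ∀ k v → count (walk k v) ≤ d ^ k
    count-walk zero    v = count-≟ v
    count-walk (suc k) v = begin
      count (walk (suc k) v)
        ≤⟨ count-anyFin (λ a w → walk k v a ∧ adj G a w) ⟩
      sum (λ a → count (λ w → walk k v a ∧ adj G a w))
        ≡⟨ sum-cong-≗ (λ a → trans (count-∧ (walk k v a) (adj G a)) (degree≡d a)) ⟩
      sum (λ a → boolToℕ (walk k v a) * d)
        ≡⟨ count-weighted (walk k v) d ⟩
      count (walk k v) * d
        ≤⟨ ℕₚ.*-monoˡ-≤ d (count-walk k v) ⟩
      d ^ k * d
        ≡⟨ ℕₚ.*-comm (d ^ k) d ⟩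
      d ^ suc k ∎
      where
      open ℕₚ.≤-Reasoning
      degree≡d : ∀ a → boolToℕ (walk k v a) * count (adj G a) ≡ boolToℕ (walk k v a) * d
      degree≡d a = cong (boolToℕ (walk k v a) *_) (trans (≡.sym (∣tabulate∣≡count (adj G a))) (regular a))

    count-within : ∀ r v → count (within r v) ≤ ballBound d r
    count-within zero    v = count-walk 0 v
    count-within (suc r) v = ℕₚ.≤-trans (count-∨ (within r v) (walk (suc r) v))
                                       (ℕₚ.+-mono-≤ (count-within r v) (count-walk (suc r) v))

module Packings {n : ℕ} (near : Fin n → Fin n → Bool)
                (near-refl : ∀ v → near v v ≡ true)
                (near-sym : ∀ v w → near v w ≡ true → near w v ≡ true)
                (P : Fin n → Bool) where

  open import Data.Nat using (_*_; _≤_)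
  open import Data.List using (List; []; _∷_; allFin)
  open import Data.List.Relation.Unary.Any using (here; there)
  import Data.List.Membership.Propositional as List
  open import Data.List.Membership.Propositional.Properties using (∈-allFin)
  open import Algebra.Properties.Semiring.Sum ℕₚ.+-*-semiring using (sum)
  open Counting

  record Packing : Set where
    field
      size    : ℕ
      point   : Fin size → Fin n
      point-P : ∀ i → P (point i) ≡ true
      apart   : ∀ i j → i ≢ j → near (point i) (point j) ≡ false

  open Packing

  covered : Packing → Fin n → Bool
  covered p w = anyFin (λ i → near (point p i) w)

  private
    far-sym : ∀ {v w} → near v w ≡ false → near w v ≡ false
    far-sym {v} {w} far = ¬-not λ close → contradiction (trans (≡.sym (near-sym w v close)) far) λ ()

    ∅ : Packing
    ∅ = record { size = 0 ; point = λ () ; point-P = λ () ; apart = λ () }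

    extend : (p : Packing) (w : Fin n) → P w ≡ true → covered p w ≡ false → Packing
    extend p w Pw w-free = record
      { size = suc (size p) ; point = point′ ; point-P = point′-P ; apart = apart′ }
      where
      point′ : Fin (suc (size p)) → Fin n
      point′ zero    = w
      point′ (suc i) = point p i

      point′-P : ∀ i → P (point′ i) ≡ true
      point′-P zero    = Pw
      point′-P (suc i) = point-P p i

      far-from-w : ∀ i → near (point p i) w ≡ false
      far-from-w i = anyFin-false _ i w-free

      apart′ : ∀ i j → i ≢ j → near (point′ i) (point′ j) ≡ false
      apart′ zero    zero    0≢0 = contradiction refl 0≢0
      apart′ zero    (suc j) _   = far-sym (far-from-w j)
      apart′ (suc i) zero    _   = far-from-w i
      apart′ (suc i) (suc j) i≢j = apart p i j (i≢j ∘ cong suc)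

    greedy : (ws : List (Fin n)) →
      Σ Packing λ p → ∀ w → w List.∈ ws → P w ≡ true → covered p w ≡ true
    greedy [] = ∅ , λ _ ()
    greedy (w ∷ ws) with greedy ws
    ... | p , covers-ws with covered p w in w-covered | P w in Pw
    ...   | true  | _     = p , covers
      where
      covers : ∀ x → x List.∈ w ∷ ws → P x ≡ true → covered p x ≡ true
      covers x (here refl)  _  = w-covered
      covers x (there x∈ws) Px = covers-ws x x∈ws Px
    ...   | false | false = p , covers
      where
      covers : ∀ x → x List.∈ w ∷ ws → P x ≡ true → covered p x ≡ true
      covers x (here refl)  Px = contradiction (trans (≡.sym Pw) Px) λ ()
      covers x (there x∈ws) Px = covers-ws x x∈ws Px
    ...   | false | true  = extend p w Pw w-covered , covers
      where
      covers : ∀ x → x List.∈ w ∷ ws → P x ≡ true → covered (extend p w Pw w-covered) x ≡ true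
      covers x (here refl)  _  = ∨-introˡ _ (near-refl w)
      covers x (there x∈ws) Px = ∨-introʳ (near w x) (covers-ws x x∈ws Px)

  maximal-packing : Σ Packing λ p → ∀ w → P w ≡ true → covered p w ≡ true
  maximal-packing with greedy (allFin n)
  ... | p , covers = p , λ w → covers w (∈-allFin w)

  large-packing : ∀ {b} → (∀ v → count (near v) ≤ b) → Σ Packing λ p → count P ≤ size p * b
  large-packing {b} ball≤b with maximal-packing
  ... | p , covers = p , (begin
    count P                                  ≤⟨ count-mono covers ⟩
    count (covered p)                        ≤⟨ count-anyFin (λ i → near (point p i)) ⟩
    sum (λ i → count (near (point p i)))     ≤⟨ sum-mono (λ i → ball≤b (point p i)) ⟩
    sum {size p} (λ _ → b)                   ≡⟨ sum-const (size p) b ⟩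
    size p * b                               ∎)
    where open ℕₚ.≤-Reasoning

module Matchings {n : ℕ} (G : Graph n) where

  open import Data.Nat using (_≤_; _*_; z≤n; s≤s)
  open import Data.Fin.Properties using (_≟_)
  open import Data.Fin.Subset.Properties using (x∉p⇒x∈∁p)
  open import Relation.Nullary using (yes; no)
  open Walks G

  swap-isInducedMatching : ∀ {k} (M : EdgeFamily n k) →
    IsInducedMatching G M → IsInducedMatching G (swap ∘ M)
  swap-isInducedMatching M (edges , disjoint , induced) =
    (λ i → trans (sym G _ _) (edges i)) ,
    (λ i j i≢j → let (p , q , r , s) = disjoint i j i≢j in s , r , q , p) ,
    (λ x y x∈ y∈ xy → swap-edge (induced x y (swap-endpoint x∈) (swap-endpoint y∈) xy))
    where
    swap-endpoint : ∀ {x} → IsEndpoint (swap ∘ M) x → IsEndpoint M x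
    swap-endpoint (i , inj₁ e) = i , inj₂ e
    swap-endpoint (i , inj₂ e) = i , inj₁ e
    swap-edge : ∀ {x y} → EdgeIn M x y → EdgeIn (swap ∘ M) x y
    swap-edge (i , inj₁ (p , q)) = i , inj₂ (q , p)
    swap-edge (i , inj₂ (p , q)) = i , inj₁ (q , p)

  distant-isInducedMatching : ∀ {k} (g f : Fin k → Fin n) →
    (∀ i → adj G (g i) (f i) ≡ true) →
    (∀ i j → i ≢ j → within 3 (f i) (f j) ≡ false) →
    IsInducedMatching G (λ i → g i , f i)
  distant-isInducedMatching {k} g f edge distant = edge , disjoint , induced
    where
    close₀ : ∀ {v w} → v ≡ w → within 3 v w ≡ true
    close₀ {v} refl = walk⇒within 3 {v} {v} z≤n (walk-refl v)
    close₁ : ∀ {v w} → adj G v w ≡ true → within 3 v w ≡ true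
    close₁ {v} {w} e = walk⇒within 3 {v} {w} (s≤s z≤n) (walk-snoc 0 {v} {v} {w} (walk-refl v) e)
    close₂ : ∀ {v a w} → adj G v a ≡ true → adj G a w ≡ true → within 3 v w ≡ true
    close₂ {v} {a} {w} e₁ e₂ = walk⇒within 3 {v} {w} (s≤s (s≤s z≤n))
      (walk-snoc 1 {v} {a} {w} (walk-snoc 0 {v} {v} {a} (walk-refl v) e₁) e₂)
    close₃ : ∀ {v a b w} → adj G v a ≡ true → adj G a b ≡ true → adj G b w ≡ true → within 3 v w ≡ true
    close₃ {v} {a} {b} {w} e₁ e₂ e₃ = walk⇒within 3 {v} {w} ℕₚ.≤-refl
      (walk-snoc 2 {v} {b} {w}
        (walk-snoc 1 {v} {a} {b} (walk-snoc 0 {v} {v} {a} (walk-refl v) e₁) e₂) e₃)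

    same : ∀ {i j} → within 3 (f i) (f j) ≡ true → i ≡ j
    same {i} {j} close with i ≟ j
    ... | yes i≡j = i≡j
    ... | no  i≢j = contradiction (trans (≡.sym close) (distant i j i≢j)) λ ()

    disjoint : ∀ i j → i ≢ j →
      (g i ≢ g j) × (g i ≢ f j) × (f i ≢ g j) × (f i ≢ f j)
    disjoint i j i≢j =
      (λ gi≡gj → i≢j (same (close₂ (adj-sym (edge i)) (adj-≡ˡ (≡.sym gi≡gj) (edge j))))) ,
      (λ gi≡fj → i≢j (same (close₁ (adj-≡ʳ gi≡fj (adj-sym (edge i)))))) ,
      (λ fi≡gj → i≢j (same (close₁ (adj-≡ˡ (≡.sym fi≡gj) (edge j))))) ,
      (λ fi≡fj → i≢j (same (close₀ fi≡fj)))
      where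
      adj-≡ˡ : ∀ {x y w} → x ≡ y → adj G x w ≡ true → adj G y w ≡ true
      adj-≡ˡ refl e = e
      adj-≡ʳ : ∀ {v x y} → x ≡ y → adj G v x ≡ true → adj G v y ≡ true
      adj-≡ʳ refl e = e

    M : EdgeFamily n k
    M i = g i , f i

    loop : ∀ {x y} → x ≡ y → adj G x y ≡ true → EdgeIn M x y
    loop {x} refl xx = contradiction (trans (≡.sym (irrefl G x)) xx) λ ()

    induced : ∀ x y → IsEndpoint M x → IsEndpoint M y → adj G x y ≡ true → EdgeIn M x y
    induced x y (i , inj₁ refl) (j , inj₁ refl) e
      with refl ← same (close₃ (adj-sym (edge i)) e (edge j)) = loop refl e
    induced x y (i , inj₁ refl) (j , inj₂ refl) e
      with refl ← same (close₂ (adj-sym (edge i)) e) = i , inj₁ (refl , refl)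
    induced x y (i , inj₂ refl) (j , inj₁ refl) e
      with refl ← same (close₂ e (edge j)) = i , inj₂ (refl , refl)
    induced x y (i , inj₂ refl) (j , inj₂ refl) e
      with refl ← same (close₁ e) = loop refl e

  boundary : Subset n → Fin n → Bool
  boundary S v = not (v ∈ᵇ S) ∧ anyFin (λ u → (u ∈ᵇ S) ∧ adj G u v)

  module _ {d : ℕ} (regular : IsRegular d G) (S : Subset n) where

    open Packings (within 3) (λ v → walk⇒within 3 {v} {v} z≤n (walk-refl v))
                  (λ v w → within-sym 3 {v} {w}) (boundary S)
    open Packing

    boundary-matching : Σ ℕ λ k → Σ (EdgeFamily n k) λ M →
      IsInducedMatching G M × IsBetween M S (∁ S) × ∣ N G S ∣ ≤ k * ballBound d 3
    boundary-matching with large-packing (count-within regular 3)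
    ... | p , bound =
      size p , (λ i → inner i , point p i) ,
      distant-isInducedMatching inner (point p) edge (apart p) , between ,
      ℕₚ.≤-trans (ℕₚ.≤-reflexive (∣tabulate∣≡count (boundary S))) bound
      where
      neighbour : ∀ i → ∃ λ u → (u ∈ᵇ S) ∧ adj G u (point p i) ≡ true
      neighbour i = anyFin-elim _ (∧-conicalʳ _ _ (point-P p i))
      inner : Fin (size p) → Fin n
      inner i = proj₁ (neighbour i)
      edge : ∀ i → adj G (inner i) (point p i) ≡ true
      edge i = ∧-conicalʳ _ _ (proj₂ (neighbour i))
      between : IsBetween (λ i → inner i , point p i) S (∁ S)
      between i = ∈ᵇ⇒∈ (inner i) S (∧-conicalˡ _ _ (proj₂ (neighbour i))) ,
                  x∉p⇒x∈∁p (not-∈ᵇ⇒∉ (point p i) S (∧-conicalˡ _ _ (point-P p i)))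

open Matchings using (swap-isInducedMatching; boundary-matching)

-- From here on the unqualified _<_, _≤_ and _*_ are the rational ones, as in the statement.
open import Data.Fin.Subset.Properties using (x∈∁p⇒x∉p; x∉∁p⇒x∈p; ∣∁p∣≡n∸∣p∣; ∣p∣≤n)
open import Data.Integer using (+_; +≤+)
import Data.Integer as ℤ
import Data.Integer.Properties as ℤₚ
import Data.Nat.Coprimality as Coprime
open import Data.Rational using (ℚ; _<_; _≤_; _*_; 0ℚ; 1ℚ; _/_; mkℚ; *≤*; toℚᵘ; Positive; NonNegative; positive)
open import Data.Rational.Properties
  using (normalize-coprime; toℚᵘ-injective; toℚᵘ-homo-*; *-monoˡ-≤-nonNeg; *-assoc; *-identityˡ;
         pos⇒nonNeg; pos*pos⇒pos; positive⁻¹; module ≤-Reasoning)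
import Data.Rational.Unnormalised as ℚᵘ
import Data.Rational.Unnormalised.Properties as ℚᵘ
open import Data.Rational.Solver using (module +-*-Solver)

∣p∣+∣∁p∣≡n : ∀ {n} (p : Subset n) → ∣ p ∣ ℕ.+ ∣ ∁ p ∣ ≡ n
∣p∣+∣∁p∣≡n p = trans (cong (∣ p ∣ ℕ.+_) (∣∁p∣≡n∸∣p∣ p)) (ℕₚ.m+[n∸m]≡n (∣p∣≤n p))

smaller-part : ∀ {a b n} → a ℕ.≤ b → a ℕ.+ b ≡ n → 2 ℕ.* a ℕ.≤ n
smaller-part {a} a≤b a+b≡n = begin
  2 ℕ.* a        ≡⟨ cong (a ℕ.+_) (ℕₚ.+-identityʳ a) ⟩
  a ℕ.+ a        ≤⟨ ℕₚ.+-monoʳ-≤ a a≤b ⟩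
  a ℕ.+ _        ≡⟨ a+b≡n ⟩
  _              ∎
  where open ℕₚ.≤-Reasoning

swap-between-∁ : ∀ {n k} {M : EdgeFamily n k} (V : Subset n) →
  IsBetween M (∁ V) (∁ (∁ V)) → IsBetween (swap ∘ M) V (∁ V)
swap-between-∁ V between i = x∉∁p⇒x∈p (x∈∁p⇒x∉p (proj₂ (between i))) , proj₁ (between i)

ℕtoℚ≡mkℚ : ∀ k → ℕtoℚ k ≡ mkℚ (+ k) 0 (Coprime.sym (Coprime.1-coprimeTo k))
ℕtoℚ≡mkℚ k = normalize-coprime (Coprime.sym (Coprime.1-coprimeTo k))

ℕtoℚ-mono : ∀ {a b} → a ℕ.≤ b → ℕtoℚ a ≤ ℕtoℚ b
ℕtoℚ-mono {a} {b} a≤b rewrite ℕtoℚ≡mkℚ a | ℕtoℚ≡mkℚ b =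
  *≤* (subst₂ ℤ._≤_ (≡.sym (ℤₚ.*-identityʳ (+ a))) (≡.sym (ℤₚ.*-identityʳ (+ b))) (+≤+ a≤b))

ℕtoℚ-homo-* : ∀ a b → ℕtoℚ (a ℕ.* b) ≡ ℕtoℚ a * ℕtoℚ b
ℕtoℚ-homo-* a b = toℚᵘ-injective (ℚᵘ.≃-trans homo (ℚᵘ.≃-sym (toℚᵘ-homo-* (ℕtoℚ a) (ℕtoℚ b))))
  where
  homo : toℚᵘ (ℕtoℚ (a ℕ.* b)) ℚᵘ.≃ toℚᵘ (ℕtoℚ a) ℚᵘ.* toℚᵘ (ℕtoℚ b)
  homo rewrite ℕtoℚ≡mkℚ a | ℕtoℚ≡mkℚ b | ℕtoℚ≡mkℚ (a ℕ.* b) =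
    ℚᵘ.*≡* (cong (ℤ._* + 1) (ℤₚ.pos-* a b))

¹⁄₁₂₀ : ℚ
¹⁄₁₂₀ = + 1 / 120

module _ {c : ℚ} (0<c : 0ℚ < c) where

  private instance
    c-positive : Positive c
    c-positive = positive 0<c

  δ-positive : 0ℚ < c * ¹⁄₁₂₀
  δ-positive = positive⁻¹ (c * ¹⁄₁₂₀) {{pos*pos⇒pos c ¹⁄₁₂₀}}

  matching-size : ∀ {n} s m k → n ℕ.≤ 3 ℕ.* s → c * ℕtoℚ s ≤ ℕtoℚ m → m ℕ.≤ k ℕ.* 40 →
    c * ¹⁄₁₂₀ * ℕtoℚ n ≤ ℕtoℚ k
  matching-size {n} s m k n≤3s expansion m≤40k = begin
    c * ¹⁄₁₂₀ * ℕtoℚ n           ≤⟨ *-monoˡ-≤-nonNeg (c * ¹⁄₁₂₀) {{δ-nonNeg}} (ℕtoℚ-mono n≤3s) ⟩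
    c * ¹⁄₁₂₀ * ℕtoℚ (3 ℕ.* s)   ≡⟨ cong (c * ¹⁄₁₂₀ *_) (ℕtoℚ-homo-* 3 s) ⟩
    c * ¹⁄₁₂₀ * (ℕtoℚ 3 * ℕtoℚ s) ≡⟨ rearrange c ¹⁄₁₂₀ (ℕtoℚ 3) (ℕtoℚ s) ⟩
    ¹⁄₁₂₀ * (ℕtoℚ 3 * (c * ℕtoℚ s))
      ≤⟨ *-monoˡ-≤-nonNeg ¹⁄₁₂₀ (*-monoˡ-≤-nonNeg (ℕtoℚ 3) expansion) ⟩
    ¹⁄₁₂₀ * (ℕtoℚ 3 * ℕtoℚ m)    ≡⟨ cong (¹⁄₁₂₀ *_) (≡.sym (ℕtoℚ-homo-* 3 m)) ⟩
    ¹⁄₁₂₀ * ℕtoℚ (3 ℕ.* m)       ≤⟨ *-monoˡ-≤-nonNeg ¹⁄₁₂₀ (ℕtoℚ-mono 3m≤120k) ⟩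
    ¹⁄₁₂₀ * ℕtoℚ (120 ℕ.* k)     ≡⟨ cong (¹⁄₁₂₀ *_) (ℕtoℚ-homo-* 120 k) ⟩
    ¹⁄₁₂₀ * (ℕtoℚ 120 * ℕtoℚ k)  ≡⟨ ≡.sym (*-assoc ¹⁄₁₂₀ (ℕtoℚ 120) (ℕtoℚ k)) ⟩
    ¹⁄₁₂₀ * ℕtoℚ 120 * ℕtoℚ k    ≡⟨⟩
    1ℚ * ℕtoℚ k                  ≡⟨ *-identityˡ (ℕtoℚ k) ⟩
    ℕtoℚ k                       ∎
    where
    open ≤-Reasoning
    open +-*-Solver
    rearrange : ∀ c r a b → c * r * (a * b) ≡ r * (a * (c * b))
    rearrange = solve 4 (λ c r a b → c :* r :* (a :* b) := r :* (a :* (c :* b))) refl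
    δ-nonNeg : NonNegative (c * ¹⁄₁₂₀)
    δ-nonNeg = pos⇒nonNeg (c * ¹⁄₁₂₀) {{pos*pos⇒pos c ¹⁄₁₂₀}}
    3m≤120k : 3 ℕ.* m ℕ.≤ 120 ℕ.* k
    3m≤120k = ℕₚ.≤-trans (ℕₚ.*-monoʳ-≤ 3 m≤40k)
                (ℕₚ.≤-reflexive (trans (cong (3 ℕ.*_) (ℕₚ.*-comm k 40)) (≡.sym (ℕₚ.*-assoc 3 40 k))))

  expander-matching : ∀ {n} (G : Graph n) → IsExpander c 3 G →
    (S : Subset n) → 2 ℕ.* ∣ S ∣ ℕ.≤ n → n ℕ.≤ 3 ℕ.* ∣ S ∣ →
    Σ ℕ λ k → Σ (EdgeFamily n k) λ M →
      IsInducedMatching G M × IsBetween M S (∁ S) × (c * ¹⁄₁₂₀ * ℕtoℚ n ≤ ℕtoℚ k)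
  expander-matching G (regular , expands) S small large =
    -- ballBound 3 3 reduces to 40.
    let (k , M , induced , between , N≤40k) = boundary-matching G regular S
    in  k , M , induced , between , matching-size ∣ S ∣ ∣ N G S ∣ k large (expands S small) N≤40k

  balanced-matching : ∀ {n} (G : Graph n) → IsExpander c 3 G → (V₁ : Subset n) → IsBalanced V₁ →
    Σ ℕ λ k → Σ (EdgeFamily n k) λ M →
      IsInducedMatching G M × IsBetween M V₁ (∁ V₁) × (c * ¹⁄₁₂₀ * ℕtoℚ n ≤ ℕtoℚ k)
  balanced-matching G expander V₁ (n≤3∣V₁∣ , _ , n≤3∣∁V₁∣ , _) with ℕₚ.≤-total ∣ V₁ ∣ ∣ ∁ V₁ ∣
  ... | inj₁ V₁-smaller =
    expander-matching G expander V₁ (smaller-part V₁-smaller (∣p∣+∣∁p∣≡n V₁)) n≤3∣V₁∣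
  ... | inj₂ ∁V₁-smaller =
    let sizes = trans (ℕₚ.+-comm ∣ ∁ V₁ ∣ ∣ V₁ ∣) (∣p∣+∣∁p∣≡n V₁)
        (k , M , induced , between , bound) =
          expander-matching G expander (∁ V₁) (smaller-part ∁V₁-smaller sizes) n≤3∣∁V₁∣
    in  k , swap ∘ M , swap-isInducedMatching G M induced , swap-between-∁ V₁ between , bound

lemma15 : (c : ℚ) → 0ℚ < c →
    Σ ℚ λ δ → (0ℚ < δ) ×
      (∀ (n : ℕ) (G : Graph n) → IsExpander c 3 G →
        ∀ (V₁ : Subset n) → IsBalanced V₁ →
          Σ ℕ λ k → Σ (EdgeFamily n k) λ M →
            IsInducedMatching G M × IsBetween M V₁ (∁ V₁) × (δ * ℕtoℚ n ≤ ℕtoℚ k))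
lemma15 c 0<c = c * ¹⁄₁₂₀ , δ-positive 0<c , λ n → balanced-matching 0<c
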